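{- Let $q\neq1$ be real and for $n\ge1$ let $Fib_n(x,s,q)=\sum_{k=0}^{\lfloor\frac{n-1}{2}\rfloor}\begin{bmatrix} n-1-k\\ k\end{bmatrix}_q q^{\binom{k+1}{2}}s^kx^{n-1-2k}$, with $Fib_0(x,s,q)=0$. Let $D_q$ be the $q$-derivative in $x$, $D_qp(x)=\frac{p(x)-p(qx)}{(1-q)x}$ (with $s$ treated as a constant). Then for all $n\ge2$, $$Fib_n(x,s,q)=xFib_{n-1}(x,s,q)+(q-1)s\,D_qFib_{n-1}(x,s,q)+s\,Fib_{n-2}(x,s,q).$$
   Context: $D_q$ is the linear operator on polynomials in $x$ with $D_qx^n=[n]_qx^{n-1}$, $[n]_q=\frac{1-q^n}{1-q}$. -}

module Defs where

open import Level using (Level)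
open import Algebra.Bundles using (CommutativeRing)
open import Data.Nat as ℕ using (ℕ; zero; suc; _∸_)
open import Data.Nat.DivMod using (_/_)
open import Data.Nat.Combinatorics using (_C_)
open import Data.List using (List; foldr; map; upTo)
open import Data.Bool using (if_then_else_)
open import Relation.Nullary.Decidable using (⌊_⌋)

-- Everything is stated over an arbitrary commutative ring R
-- (the paper's setting q ∈ ℝ is the instance R = ℝ).
module FibDefs {c ℓ : Level} (R : CommutativeRing c ℓ) where
  open CommutativeRing R

  pow : Carrier → ℕ → Carrier
  pow x zero    = 1#
  pow x (suc n) = x * pow x n

  sumR : List Carrier → Carrier
  sumR = foldr _+_ 0#

  -- q-integer [n]_q = 1 + q + ... + q^(n-1)  ( = (1-q^n)/(1-q) for q ≠ 1 )
  qint : Carrier → ℕ → Carrier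
  qint q n = sumR (map (pow q) (upTo n))

  qbin : Carrier → ℕ → ℕ → Carrier
  qbin q n       zero    = 1#
  qbin q zero    (suc k) = 0#
  qbin q (suc n) (suc k) = qbin q n k + pow q (suc k) * qbin q n (suc k)

  -- polynomials in x with coefficients in R, as coefficient functions
  -- (p j = coefficient of x^j)
  Poly : Set c
  Poly = ℕ → Carrier

  zeroP : Poly
  zeroP j = 0#

  _+P_ : Poly → Poly → Poly
  (p +P r) j = p j + r j

  sumP : List Poly → Poly
  sumP = foldr _+P_ zeroP

  monomial : Carrier → ℕ → Poly
  monomial a e j = if ⌊ j ℕ.≟ e ⌋ then a else 0#

  mulX : Poly → Poly
  mulX p zero    = 0#
  mulX p (suc j) = p j

  _·P_ : Carrier → Poly → Poly
  (a ·P p) j = a * p j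

  -- q-derivative: D_q x^n = [n]_q x^(n-1), extended linearly
  Dq : Carrier → Poly → Poly
  Dq q p j = qint q (suc j) * p (suc j)

  Fib : Carrier → Carrier → ℕ → Poly
  Fib q s zero    = zeroP
  Fib q s (suc m) =
    sumP (map (λ k → monomial (qbin q (m ∸ k) k * pow q (suc k C 2) * pow s k)
                              (m ∸ (2 ℕ.* k)))
              (upTo (suc (m / 2))))

{-# OPTIONS --safe #-}
-- Compare coefficients of x^j.  The coefficient of x^j in Fib_n vanishes unless
-- n = 2k + j + 1, where it is [k+j, k]_q q^C(k+1,2) s^k.  Hence in the recurrence at x^j
-- every term vanishes unless Fib_(m+2) has x^j as its leading term (both sides are 1)
-- or as an interior term; dividing the interior case by q^C(k+1,2) s^(k+1) leaves the
-- q-binomial identity (n = k + j)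
--   q^(k+1) [n+1, k+1] = q^(k+1) [n, k+1] + (q - 1) [j+1] [n+1, k] + [n, k].
-- It follows from the absorption identity [k+1] [n, k+1] = [j] [n, k], proved by
-- induction from the defining q-Pascal rule, and its two consequences: the second
-- q-Pascal rule [n+1, k+1] = q^j [n, k] + [n, k+1] and [n+1] [n, k] = [j+1] [n+1, k].
module Submission where

open import Defs
open import Level using (Level)
open import Algebra.Bundles using (CommutativeRing)
open import Data.Nat using (ℕ; suc)
open import Relation.Nullary using (¬_)

open import Data.Nat as ℕ using (zero; s≤s; z<s; s<s; s≤s⁻¹)
import Data.Nat.Properties as ℕₚ
open import Data.Nat.DivMod using (_/_; m/n*n≤m; m*n/n≡m; /-monoˡ-≤)
open import Data.Nat.Combinatorics using (_C_; nC1≡n; nCk+nC[k+1]≡[n+1]C[k+1])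
open import Data.List using ([]; _∷_; map; upTo; applyUpTo)
open import Data.List.Properties using (map-upTo; map-applyUpTo)
open import Data.Sum using (inj₁; inj₂)
open import Function using (_∘_)
open import Relation.Nullary using (yes; no)
open import Data.Empty using (⊥-elim)
open import Relation.Binary.PropositionalEquality as ≡ using (_≡_; _≢_; cong)

module _ where
  open import Data.Nat using (_+_; _*_; _∸_; _≤_; _<_)
  open ℕₚ using (+-identityʳ; +-assoc; +-cancelʳ-≡; *-suc; *-comm; *-cancelˡ-≡; *-monoʳ-≤; m≤m+n; m+n∸m≡n; m+[n∸m]≡n;
                 ≤-trans; ≤-reflexive; m≤n⇒m<n∨m≡n)

  k≤m/2⇒2*k≤m : ∀ {k m} → k ≤ m / 2 → 2 * k ≤ m
  k≤m/2⇒2*k≤m {k} {m} k≤m/2 = ≤-trans (*-monoʳ-≤ 2 k≤m/2) (≤-trans (≤-reflexive (*-comm 2 (m / 2))) (m/n*n≤m m 2))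

  k≤[2*k+j]/2 : ∀ k j → k ≤ (2 * k + j) / 2
  k≤[2*k+j]/2 k j = ≤-trans (≤-reflexive (≡.sym (m*n/n≡m k 2)))
    (/-monoˡ-≤ 2 (≤-trans (≤-reflexive (*-comm k 2)) (m≤m+n (2 * k) j)))

  [2*k+j]∸k≡k+j : ∀ k j → 2 * k + j ∸ k ≡ k + j
  [2*k+j]∸k≡k+j k j = ≡.trans (cong (λ n → n + j ∸ k) (cong (k +_) (+-identityʳ k)))
    (≡.trans (cong (_∸ k) (+-assoc k k j)) (m+n∸m≡n k (k + j)))

  [2+k]C2≡1+k+[1+k]C2 : ∀ k → suc (suc k) C 2 ≡ suc k + suc k C 2
  [2+k]C2≡1+k+[1+k]C2 k = ≡.trans (≡.sym (nCk+nC[k+1]≡[n+1]C[k+1] (suc k) 1)) (cong (_+ suc k C 2) (nC1≡n (suc k)))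

  m∸n≡o⇒m≡n+o : ∀ {m n o} → n ≤ m → m ∸ n ≡ o → m ≡ n + o
  m∸n≡o⇒m≡n+o n≤m m∸n≡o = ≡.trans (≡.sym (m+[n∸m]≡n n≤m)) (cong (_ +_) m∸n≡o)

  2*k+j-injective : ∀ {k k′} j → 2 * k + j ≡ 2 * k′ + j → k ≡ k′
  2*k+j-injective {k} {k′} j eq = *-cancelˡ-≡ k k′ 2 (+-cancelʳ-≡ j (2 * k) (2 * k′) eq)

  2*[1+k]+j≡2+[2*k+j] : ∀ k j → 2 * suc k + j ≡ suc (suc (2 * k + j))
  2*[1+k]+j≡2+[2*k+j] k j = cong (_+ j) (*-suc 2 k)

  -- Where x^j sits relative to the exponents m+1, m-1, m-3, ... of Fib_(m+2).
  data Position (m j : ℕ) : Set where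
    beyond   : suc m < j → Position m j
    leading  : j ≡ suc m → Position m j
    interior : ∀ k → m ≡ suc (2 * k + j) → Position m j
    gap      : ∀ k → m ≡ 2 * k + j → Position m j

  position : ∀ m j → Position m j
  position zero zero          = gap 0 ≡.refl
  position zero (suc zero)    = leading ≡.refl
  position zero (suc (suc j)) = beyond (s<s z<s)
  position (suc m) j with position m j
  ... | beyond 2+m≤j with m≤n⇒m<n∨m≡n 2+m≤j
  ...   | inj₁ 3+m≤j = beyond 3+m≤j
  ...   | inj₂ 2+m≡j = leading (≡.sym 2+m≡j)
  position (suc m) j | leading ≡.refl = gap 0 ≡.refl
  position (suc m) j | interior k m≡1+2k+j =
    gap (suc k) (≡.trans (cong suc m≡1+2k+j) (≡.sym (2*[1+k]+j≡2+[2*k+j] k j)))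
  position (suc m) j | gap k m≡2k+j = interior k (cong suc m≡2k+j)

module FibRecurrence {c ℓ : Level} (R : CommutativeRing c ℓ) where
  open CommutativeRing R
  open FibDefs R
  open import Relation.Binary.Reasoning.Setoid setoid
  open import Algebra.Solver.Ring.NaturalCoefficients.Default commutativeSemiring

  sumR-applyUpTo-≈0 : ∀ (f : ℕ → Carrier) n → (∀ i → i ℕ.< n → f i ≈ 0#) → sumR (applyUpTo f n) ≈ 0#
  sumR-applyUpTo-≈0 f zero    _   = refl
  sumR-applyUpTo-≈0 f (suc n) f≈0 = begin
    f 0 + sumR (applyUpTo (f ∘ suc) n)
      ≈⟨ +-cong (f≈0 0 z<s) (sumR-applyUpTo-≈0 (f ∘ suc) n (λ i i<n → f≈0 (suc i) (s<s i<n))) ⟩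
    0# + 0# ≈⟨ +-identityˡ 0# ⟩
    0# ∎

  sumR-applyUpTo-≈single : ∀ (f : ℕ → Carrier) {n i} → i ℕ.< n → (∀ k → k ℕ.< n → k ≢ i → f k ≈ 0#) →
                           sumR (applyUpTo f n) ≈ f i
  sumR-applyUpTo-≈single f {suc n} {zero} _ others = begin
    f 0 + sumR (applyUpTo (f ∘ suc) n)
      ≈⟨ +-congˡ (sumR-applyUpTo-≈0 (f ∘ suc) n (λ k k<n → others (suc k) (s<s k<n) λ ())) ⟩
    f 0 + 0# ≈⟨ +-identityʳ (f 0) ⟩
    f 0 ∎
  sumR-applyUpTo-≈single f {suc n} {suc i} (s<s i<n) others = begin
    f 0 + sumR (applyUpTo (f ∘ suc) n)
      ≈⟨ +-cong (others 0 z<s λ ()) (sumR-applyUpTo-≈single (f ∘ suc) i<n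
                 (λ k k<n k≢i → others (suc k) (s<s k<n) (k≢i ∘ ℕₚ.suc-injective))) ⟩
    0# + f (suc i) ≈⟨ +-identityˡ (f (suc i)) ⟩
    f (suc i) ∎

  sumR-map-*ˡ : ∀ a xs → sumR (map (a *_) xs) ≈ a * sumR xs
  sumR-map-*ˡ a []       = sym (zeroʳ a)
  sumR-map-*ˡ a (x ∷ xs) = begin
    a * x + sumR (map (a *_) xs) ≈⟨ +-congˡ (sumR-map-*ˡ a xs) ⟩
    a * x + a * sumR xs          ≈⟨ distribˡ a x (sumR xs) ⟨
    a * (x + sumR xs)            ∎

  sumP-map : ∀ {A : Set} (F : A → Poly) xs j → sumP (map F xs) j ≡ sumR (map (λ x → F x j) xs)
  sumP-map F []       j = ≡.refl
  sumP-map F (x ∷ xs) j = cong (F x j +_) (sumP-map F xs j)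

  monomial-≡ : ∀ a {e j} → e ≡ j → monomial a e j ≡ a
  monomial-≡ a {e} ≡.refl with e ℕ.≟ e
  ... | yes _   = ≡.refl
  ... | no e≢e = ⊥-elim (e≢e ≡.refl)

  monomial-≢ : ∀ a {e j} → j ≢ e → monomial a e j ≡ 0#
  monomial-≢ a {e} {j} j≢e with j ℕ.≟ e
  ... | yes j≡e = ⊥-elim (j≢e j≡e)
  ... | no _    = ≡.refl

  x≈1+[x-1] : ∀ x → x ≈ 1# + (x - 1#)
  x≈1+[x-1] x = begin
    x                 ≈⟨ +-identityʳ x ⟨
    x + 0#            ≈⟨ +-congˡ (-‿inverseˡ 1#) ⟨
    x + (- 1# + 1#)   ≈⟨ +-assoc x (- 1#) 1# ⟨
    (x - 1#) + 1#     ≈⟨ +-comm (x - 1#) 1# ⟩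
    1# + (x - 1#)     ∎

  module _ (q : Carrier) where

    pow-+ : ∀ a b → pow q (a ℕ.+ b) ≈ pow q a * pow q b
    pow-+ zero    b = sym (*-identityˡ (pow q b))
    pow-+ (suc a) b = trans (*-congˡ (pow-+ a b)) (sym (*-assoc q (pow q a) (pow q b)))

    qint-suc : ∀ n → qint q (suc n) ≈ 1# + q * qint q n
    qint-suc n = +-congˡ (begin
      sumR (map (pow q) (applyUpTo suc n))         ≡⟨ cong sumR (map-applyUpTo suc (pow q) n) ⟩
      sumR (applyUpTo (λ i → q * pow q i) n)       ≡⟨ cong sumR (map-applyUpTo (pow q) (q *_) n) ⟨
      sumR (map (q *_) (applyUpTo (pow q) n))      ≈⟨ sumR-map-*ˡ q (applyUpTo (pow q) n) ⟩
      q * sumR (applyUpTo (pow q) n)               ≡⟨ cong (λ xs → q * sumR xs) (map-upTo (pow q) n) ⟨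
      q * qint q n                                 ∎)

    qint-+ : ∀ a b → qint q (a ℕ.+ b) ≈ qint q a + pow q a * qint q b
    qint-+ zero    b = sym (trans (+-identityˡ _) (*-identityˡ (qint q b)))
    qint-+ (suc a) b = begin
      qint q (suc (a ℕ.+ b))                         ≈⟨ qint-suc (a ℕ.+ b) ⟩
      1# + q * qint q (a ℕ.+ b)                      ≈⟨ +-congˡ (*-congˡ (qint-+ a b)) ⟩
      1# + q * (qint q a + pow q a * qint q b)
        ≈⟨ solve 4 (λ q x p y → con 1 :+ q :* (x :+ p :* y) := (con 1 :+ q :* x) :+ (q :* p) :* y)
                 refl q (qint q a) (pow q a) (qint q b) ⟩
      (1# + q * qint q a) + (q * pow q a) * qint q b ≈⟨ +-congʳ (qint-suc a) ⟨
      qint q (suc a) + pow q (suc a) * qint q b    ∎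

    qint-sucʳ : ∀ n → qint q (suc n) ≈ qint q n + pow q n
    qint-sucʳ n = begin
      qint q (suc n)                  ≡⟨ cong (qint q) (ℕₚ.+-comm n 1) ⟨
      qint q (n ℕ.+ 1)                ≈⟨ qint-+ n 1 ⟩
      qint q n + pow q n * (1# + 0#)  ≈⟨ +-congˡ (trans (*-congˡ (+-identityʳ 1#)) (*-identityʳ (pow q n))) ⟩
      qint q n + pow q n              ∎

    pow≈1+[q-1]*qint : ∀ n → pow q n ≈ 1# + (q - 1#) * qint q n
    pow≈1+[q-1]*qint zero    = solve 1 (λ d → con 1 := con 1 :+ d :* con 0) refl (q - 1#)
    pow≈1+[q-1]*qint (suc n) = begin
      q * pow q n                         ≈⟨ *-congˡ (pow≈1+[q-1]*qint n) ⟩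
      q * (1# + (q - 1#) * qint q n)
        ≈⟨ solve 3 (λ q d x → q :* (con 1 :+ d :* x) := q :+ d :* (q :* x)) refl q (q - 1#) (qint q n) ⟩
      q + (q - 1#) * (q * qint q n)       ≈⟨ +-congʳ (x≈1+[x-1] q) ⟩
      (1# + (q - 1#)) + (q - 1#) * (q * qint q n)
        ≈⟨ solve 2 (λ d y → (con 1 :+ d) :+ d :* y := con 1 :+ d :* (con 1 :+ y)) refl (q - 1#) (q * qint q n) ⟩
      1# + (q - 1#) * (1# + q * qint q n) ≈⟨ +-congˡ (*-congˡ (qint-suc n)) ⟨
      1# + (q - 1#) * qint q (suc n)      ∎

    qbin-vanish : ∀ {n k} → n ℕ.< k → qbin q n k ≈ 0#
    qbin-vanish {zero}  {suc k} _         = refl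
    qbin-vanish {suc n} {suc k} (s<s n<k) = begin
      qbin q n k + pow q (suc k) * qbin q n (suc k)
        ≈⟨ +-cong (qbin-vanish n<k) (*-congˡ (qbin-vanish (ℕₚ.m<n⇒m<1+n n<k))) ⟩
      0# + pow q (suc k) * 0#  ≈⟨ solve 1 (λ p → con 0 :+ p :* con 0 := con 0) refl (pow q (suc k)) ⟩
      0#                       ∎

    qbin-1 : ∀ n → qbin q n 1 ≈ qint q n
    qbin-1 zero    = refl
    qbin-1 (suc n) = begin
      1# + (q * 1#) * qbin q n 1 ≈⟨ +-congˡ (*-cong (*-identityʳ q) (qbin-1 n)) ⟩
      1# + q * qint q n          ≈⟨ qint-suc n ⟨
      qint q (suc n)             ∎

    qbin-absorb : ∀ k a → qint q (suc k) * qbin q (k ℕ.+ a) (suc k) ≈ qint q a * qbin q (k ℕ.+ a) k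
    qbin-absorb zero    a       = begin
      (1# + 0#) * qbin q a 1 ≈⟨ *-congˡ (qbin-1 a) ⟩
      (1# + 0#) * qint q a   ≈⟨ solve 1 (λ x → (con 1 :+ con 0) :* x := x :* con 1) refl (qint q a) ⟩
      qint q a * 1#          ∎
    qbin-absorb (suc k) zero    = begin
      qint q (suc (suc k)) * qbin q (suc k ℕ.+ 0) (suc (suc k))
        ≈⟨ *-congˡ (qbin-vanish (s<s (s≤s (ℕₚ.≤-reflexive (ℕₚ.+-identityʳ k))))) ⟩
      qint q (suc (suc k)) * 0# ≈⟨ zeroʳ _ ⟩
      0#                        ≈⟨ zeroˡ _ ⟨
      0# * qbin q (suc k ℕ.+ 0) (suc k) ∎
    qbin-absorb (suc k) (suc a) = begin
      K₂ * (X + (q * P) * Y)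
        ≈⟨ solve 5 (λ k₂ x q p y → k₂ :* (x :+ (q :* p) :* y) := k₂ :* x :+ (q :* p) :* (k₂ :* y)) refl K₂ X q P Y ⟩
      K₂ * X + (q * P) * (K₂ * Y)            ≈⟨ +-cong (*-congʳ (qint-sucʳ (suc k))) (*-congˡ absorb-Y) ⟩
      (K₁ + P) * X + (q * P) * (A * X)
        ≈⟨ solve 5 (λ k₁ p x q a → (k₁ :+ p) :* x :+ (q :* p) :* (a :* x) := k₁ :* x :+ p :* ((con 1 :+ q :* a) :* x))
                 refl K₁ P X q A ⟩
      K₁ * X + P * ((1# + q * A) * X)        ≈⟨ +-cong (qbin-absorb k (suc a)) (*-congˡ (*-congʳ (sym (qint-suc a)))) ⟩
      A₁ * W + P * (A₁ * X)
        ≈⟨ solve 4 (λ a₁ w p x → a₁ :* w :+ p :* (a₁ :* x) := a₁ :* (w :+ p :* x)) refl A₁ W P X ⟩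
      A₁ * (W + P * X)                       ∎
      where
      n  = k ℕ.+ suc a
      W  = qbin q n k
      X  = qbin q n (suc k)
      Y  = qbin q n (suc (suc k))
      P  = pow q (suc k)
      K₁ = qint q (suc k)
      K₂ = qint q (suc (suc k))
      A  = qint q a
      A₁ = qint q (suc a)
      absorb-Y : K₂ * Y ≈ A * X
      absorb-Y = ≡.subst (λ m → K₂ * qbin q m (suc (suc k)) ≈ A * qbin q m (suc k))
                         (≡.sym (ℕₚ.+-suc k a)) (qbin-absorb (suc k) a)

    qbin-pascalʳ : ∀ k j → qbin q (suc (k ℕ.+ j)) (suc k) ≈ pow q j * qbin q (k ℕ.+ j) k + qbin q (k ℕ.+ j) (suc k)
    qbin-pascalʳ k j = begin
      W + pow q (suc k) * X                   ≈⟨ +-congˡ (*-congʳ (pow≈1+[q-1]*qint (suc k))) ⟩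
      W + (1# + d * qint q (suc k)) * X
        ≈⟨ solve 4 (λ w d k₁ x → w :+ (con 1 :+ d :* k₁) :* x := w :+ x :+ d :* (k₁ :* x)) refl W d (qint q (suc k)) X ⟩
      W + X + d * (qint q (suc k) * X)        ≈⟨ +-congˡ (*-congˡ (qbin-absorb k j)) ⟩
      W + X + d * (qint q j * W)
        ≈⟨ solve 4 (λ w x d a → w :+ x :+ d :* (a :* w) := (con 1 :+ d :* a) :* w :+ x) refl W X d (qint q j) ⟩
      (1# + d * qint q j) * W + X             ≈⟨ +-congʳ (*-congʳ (pow≈1+[q-1]*qint j)) ⟨
      pow q j * W + X                         ∎
      where
      d = q - 1#
      W = qbin q (k ℕ.+ j) k
      X = qbin q (k ℕ.+ j) (suc k)

    qbin-absorb-top : ∀ k j → qint q (suc (k ℕ.+ j)) * qbin q (k ℕ.+ j) k ≈ qint q (suc j) * qbin q (suc (k ℕ.+ j)) k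
    qbin-absorb-top k j = begin
      qint q (suc k ℕ.+ j) * W                     ≈⟨ *-congʳ (qint-+ (suc k) j) ⟩
      (K₁ + P * qint q j) * W
        ≈⟨ solve 4 (λ k₁ p a w → (k₁ :+ p :* a) :* w := k₁ :* w :+ p :* (a :* w)) refl K₁ P (qint q j) W ⟩
      K₁ * W + P * (qint q j * W)                  ≈⟨ +-congˡ (*-congˡ (qbin-absorb k j)) ⟨
      K₁ * W + P * (K₁ * X)
        ≈⟨ solve 4 (λ k₁ w p x → k₁ :* w :+ p :* (k₁ :* x) := k₁ :* (w :+ p :* x)) refl K₁ W P X ⟩
      K₁ * qbin q (suc (k ℕ.+ j)) (suc k)          ≈⟨ absorb-top ⟩
      qint q (suc j) * qbin q (suc (k ℕ.+ j)) k    ∎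
      where
      W  = qbin q (k ℕ.+ j) k
      X  = qbin q (k ℕ.+ j) (suc k)
      P  = pow q (suc k)
      K₁ = qint q (suc k)
      absorb-top : K₁ * qbin q (suc (k ℕ.+ j)) (suc k) ≈ qint q (suc j) * qbin q (suc (k ℕ.+ j)) k
      absorb-top = ≡.subst (λ m → K₁ * qbin q m (suc k) ≈ qint q (suc j) * qbin q m k)
                           (ℕₚ.+-suc k j) (qbin-absorb k (suc j))

    qbin-step : ∀ k j →
      pow q (suc k) * qbin q (suc (k ℕ.+ j)) (suc k)
        ≈ (pow q (suc k) * qbin q (k ℕ.+ j) (suc k) + (q - 1#) * (qint q (suc j) * qbin q (suc (k ℕ.+ j)) k))
          + qbin q (k ℕ.+ j) k
    qbin-step k j = begin
      P * qbin q (suc (k ℕ.+ j)) (suc k)         ≈⟨ *-congˡ (qbin-pascalʳ k j) ⟩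
      P * (pow q j * W + X)
        ≈⟨ solve 4 (λ p p′ w x → p :* (p′ :* w :+ x) := (p :* p′) :* w :+ p :* x) refl P (pow q j) W X ⟩
      (P * pow q j) * W + P * X
        ≈⟨ +-congʳ (*-congʳ (trans (sym (pow-+ (suc k) j)) (pow≈1+[q-1]*qint (suc (k ℕ.+ j))))) ⟩
      (1# + d * qint q (suc (k ℕ.+ j))) * W + P * X
        ≈⟨ solve 5 (λ d n w p x → (con 1 :+ d :* n) :* w :+ p :* x := (p :* x :+ d :* (n :* w)) :+ w)
                 refl d (qint q (suc (k ℕ.+ j))) W P X ⟩
      (P * X + d * (qint q (suc (k ℕ.+ j)) * W)) + W ≈⟨ +-congʳ (+-congˡ (*-congˡ (qbin-absorb-top k j))) ⟩
      (P * X + d * (qint q (suc j) * qbin q (suc (k ℕ.+ j)) k)) + W ∎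
      where
      d = q - 1#
      P = pow q (suc k)
      W = qbin q (k ℕ.+ j) k
      X = qbin q (k ℕ.+ j) (suc k)

  module _ (q s : Carrier) where

    fibCoeff : ℕ → ℕ → Carrier
    fibCoeff n k = qbin q n k * pow q (suc k C 2) * pow s k

    fibCoeff-step : ∀ k j →
      fibCoeff (suc (k ℕ.+ j)) (suc k)
        ≈ (fibCoeff (k ℕ.+ j) (suc k) + ((q - 1#) * s) * (qint q (suc j) * fibCoeff (suc (k ℕ.+ j)) k))
          + s * fibCoeff (k ℕ.+ j) k
    fibCoeff-step k j = begin
      Y * pow q (suc (suc k) C 2) * (s * S)      ≈⟨ *-congʳ (*-congˡ pow-C2) ⟩
      Y * (P * E) * (s * S)
        ≈⟨ solve 5 (λ y p e s S → y :* (p :* e) :* (s :* S) := (p :* y) :* (e :* (s :* S))) refl Y P E s S ⟩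
      (P * Y) * (E * (s * S))                    ≈⟨ *-congʳ (qbin-step q k j) ⟩
      ((P * X + d * (J * Z)) + W) * (E * (s * S))
        ≈⟨ solve 9 (λ p x d J z w e s S →
                      ((p :* x :+ d :* (J :* z)) :+ w) :* (e :* (s :* S))
                   := (x :* (p :* e) :* (s :* S) :+ (d :* s) :* (J :* (z :* e :* S))) :+ s :* (w :* e :* S))
                 refl P X d J Z W E s S ⟩
      (X * (P * E) * (s * S) + (d * s) * (J * (Z * E * S))) + s * (W * E * S)
        ≈⟨ +-congʳ (+-congʳ (*-congʳ (*-congˡ pow-C2))) ⟨
      (X * pow q (suc (suc k) C 2) * (s * S) + (d * s) * (J * (Z * E * S))) + s * (W * E * S) ∎
      where
      n = k ℕ.+ j
      d = q - 1#
      P = pow q (suc k)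
      E = pow q (suc k C 2)
      S = pow s k
      J = qint q (suc j)
      W = qbin q n k
      X = qbin q n (suc k)
      Y = qbin q (suc n) (suc k)
      Z = qbin q (suc n) k
      pow-C2 : pow q (suc (suc k) C 2) ≈ P * E
      pow-C2 = trans (reflexive (cong (pow q) ([2+k]C2≡1+k+[1+k]C2 k))) (pow-+ q (suc k) (suc k C 2))

    Fib-as-sum : ∀ m j →
      Fib q s (suc m) j ≡ sumR (applyUpTo (λ k → monomial (fibCoeff (m ℕ.∸ k) k) (m ℕ.∸ 2 ℕ.* k) j) (suc (m / 2)))
    Fib-as-sum m j = ≡.trans (sumP-map _ (upTo (suc (m / 2))) j) (cong sumR (map-upTo _ (suc (m / 2))))

    Fib-coeff-≈0 : ∀ {m j} → (∀ k → m ≢ 2 ℕ.* k ℕ.+ j) → Fib q s (suc m) j ≈ 0#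
    Fib-coeff-≈0 {m} {j} m≢2k+j = trans (reflexive (Fib-as-sum m j)) (sumR-applyUpTo-≈0 _ (suc (m / 2)) term≈0)
      where
      term≈0 : ∀ k → k ℕ.< suc (m / 2) → monomial (fibCoeff (m ℕ.∸ k) k) (m ℕ.∸ 2 ℕ.* k) j ≈ 0#
      term≈0 k k<1+m/2 = reflexive (monomial-≢ _ λ j≡m∸2k →
        m≢2k+j k (m∸n≡o⇒m≡n+o (k≤m/2⇒2*k≤m (s≤s⁻¹ k<1+m/2)) (≡.sym j≡m∸2k)))

    Fib-coeff : ∀ {m j n} k → m ≡ 2 ℕ.* k ℕ.+ j → n ≡ k ℕ.+ j → Fib q s (suc m) j ≈ fibCoeff n k
    Fib-coeff {j = j} k ≡.refl ≡.refl = begin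
      Fib q s (suc m) j                      ≡⟨ Fib-as-sum m j ⟩
      sumR (applyUpTo term (suc (m / 2)))    ≈⟨ sumR-applyUpTo-≈single term (s≤s (k≤[2*k+j]/2 k j)) term≈0 ⟩
      term k                                 ≡⟨ monomial-≡ _ (ℕₚ.m+n∸m≡n (2 ℕ.* k) j) ⟩
      fibCoeff (m ℕ.∸ k) k                   ≡⟨ cong (λ n → fibCoeff n k) ([2*k+j]∸k≡k+j k j) ⟩
      fibCoeff (k ℕ.+ j) k                   ∎
      where
      m = 2 ℕ.* k ℕ.+ j
      term : ℕ → Carrier
      term k′ = monomial (fibCoeff (m ℕ.∸ k′) k′) (m ℕ.∸ 2 ℕ.* k′) j
      term≈0 : ∀ k′ → k′ ℕ.< suc (m / 2) → k′ ≢ k → term k′ ≈ 0#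
      term≈0 k′ k′<1+m/2 k′≢k = reflexive (monomial-≢ _ λ j≡m∸2k′ →
        k′≢k (2*k+j-injective j (≡.sym (m∸n≡o⇒m≡n+o (k≤m/2⇒2*k≤m (s≤s⁻¹ k′<1+m/2)) (≡.sym j≡m∸2k′)))))

    Fib-degree : ∀ {n j} → n ℕ.≤ j → Fib q s n j ≈ 0#
    Fib-degree {zero}      _   = refl
    Fib-degree {suc m} {j} m<j = Fib-coeff-≈0 λ k → ℕₚ.<⇒≢ (ℕₚ.≤-trans m<j (ℕₚ.m≤n+m j (2 ℕ.* k)))

    Fib-odd-gap : ∀ {m j} k → m ≡ suc (2 ℕ.* k ℕ.+ j) → Fib q s (suc m) j ≈ 0#
    Fib-odd-gap {j = j} k ≡.refl = Fib-coeff-≈0 λ k′ eq →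
      ℕₚ.even≢odd k′ k (ℕₚ.+-cancelʳ-≡ j _ _ (≡.sym eq))

    Fib-even-gap : ∀ {n j} k → n ≡ 2 ℕ.* k ℕ.+ j → Fib q s n j ≈ 0#
    Fib-even-gap {j = j} zero ≡.refl = Fib-degree (ℕₚ.≤-refl {j})
    Fib-even-gap {suc _} {j} (suc k) eq =
      Fib-odd-gap k (ℕₚ.suc-injective (≡.trans eq (2*[1+k]+j≡2+[2*k+j] k j)))

    mulX-Fib-odd-gap : ∀ k j → mulX (Fib q s (suc (2 ℕ.* k ℕ.+ j))) j ≈ 0#
    mulX-Fib-odd-gap k zero    = refl
    mulX-Fib-odd-gap k (suc i) = Fib-odd-gap k (ℕₚ.+-suc (2 ℕ.* k) i)

    mulX-Fib-coeff : ∀ k j → mulX (Fib q s (suc (suc (2 ℕ.* k ℕ.+ j)))) j ≈ fibCoeff (k ℕ.+ j) (suc k)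
    mulX-Fib-coeff k zero    = sym (begin
      qbin q (k ℕ.+ 0) (suc k) * pow q (suc (suc k) C 2) * pow s (suc k)
        ≈⟨ *-congʳ (*-congʳ (qbin-vanish q (s≤s (ℕₚ.≤-reflexive (ℕₚ.+-identityʳ k))))) ⟩
      0# * pow q (suc (suc k) C 2) * pow s (suc k) ≈⟨ trans (*-congʳ (zeroˡ _)) (zeroˡ _) ⟩
      0#                                           ∎)
    mulX-Fib-coeff k (suc i) = Fib-coeff (suc k)
      (≡.trans (cong suc (ℕₚ.+-suc (2 ℕ.* k) i)) (≡.sym (2*[1+k]+j≡2+[2*k+j] k i))) (ℕₚ.+-suc k i)

    Recurrence : ℕ → ℕ → Set ℓ
    Recurrence m j =
      Fib q s (suc (suc m)) j
        ≈ (mulX (Fib q s (suc m)) j + (((q - 1#) * s) ·P Dq q (Fib q s (suc m))) j) + (s ·P Fib q s m) j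

    recurrence-from-coeffs : ∀ {m j a b c e} →
      Fib q s (suc (suc m)) j ≈ a → mulX (Fib q s (suc m)) j ≈ b → Fib q s (suc m) (suc j) ≈ c → Fib q s m j ≈ e →
      a ≈ (b + ((q - 1#) * s) * (qint q (suc j) * c)) + s * e → Recurrence m j
    recurrence-from-coeffs ≈a ≈b ≈c ≈e a≈ =
      trans ≈a (trans a≈ (sym (+-cong (+-cong ≈b (*-congˡ (*-congˡ ≈c))) (*-congˡ ≈e))))

    0≈0+x*[y*0]+s*0 : ∀ x y → 0# ≈ (0# + x * (y * 0#)) + s * 0#
    0≈0+x*[y*0]+s*0 x y = solve 3 (λ x y s → con 0 := (con 0 :+ x :* (y :* con 0)) :+ s :* con 0) refl x y s

    fib-recurrence : ∀ m j → Recurrence m j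
    fib-recurrence m j with position m j
    ... | beyond (s≤s (s≤s m≤i)) = recurrence-from-coeffs
      (Fib-degree (s≤s (s≤s m≤i))) (Fib-degree (s≤s m≤i))
      (Fib-degree (s≤s (ℕₚ.m≤n⇒m≤1+n (ℕₚ.m≤n⇒m≤1+n m≤i)))) (Fib-degree (ℕₚ.m≤n⇒m≤1+n (ℕₚ.m≤n⇒m≤1+n m≤i)))
      (0≈0+x*[y*0]+s*0 _ _)
    ... | leading ≡.refl = recurrence-from-coeffs   -- fibCoeff n 0 does not depend on n
      (Fib-coeff 0 ≡.refl ≡.refl) (Fib-coeff 0 ≡.refl ≡.refl)
      (Fib-degree (s≤s (ℕₚ.n≤1+n m))) (Fib-degree (ℕₚ.n≤1+n m))
      (solve 4 (λ a x y s → a := (a :+ x :* (y :* con 0)) :+ s :* con 0) refl (fibCoeff m 0) _ _ s)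
    ... | interior k ≡.refl = recurrence-from-coeffs
      (Fib-coeff (suc k) (≡.sym (2*[1+k]+j≡2+[2*k+j] k j)) ≡.refl) (mulX-Fib-coeff k j)
      (Fib-coeff k (≡.sym (ℕₚ.+-suc (2 ℕ.* k) j)) (≡.sym (ℕₚ.+-suc k j))) (Fib-coeff k ≡.refl ≡.refl)
      (fibCoeff-step k j)
    ... | gap k ≡.refl = recurrence-from-coeffs
      (Fib-odd-gap k ≡.refl) (mulX-Fib-odd-gap k j)
      (Fib-even-gap k (≡.sym (ℕₚ.+-suc (2 ℕ.* k) j))) (Fib-even-gap k ≡.refl)
      (0≈0+x*[y*0]+s*0 _ _)

mainTheorem10 : {c ℓ : Level} (R : CommutativeRing c ℓ) →
    let open CommutativeRing R
        open FibDefs R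
    in (q s : Carrier) → ¬ (q ≈ 1#) → (m : ℕ) → (j : ℕ) →
       Fib q s (suc (suc m)) j
         ≈ (mulX (Fib q s (suc m)) j
            + (((q - 1#) * s) ·P Dq q (Fib q s (suc m))) j)
            + (s ·P Fib q s m) j
-- The identity is polynomial in q.
mainTheorem10 R q s _ = FibRecurrence.fib-recurrence R q s
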